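{- For every integer $n\geq 2$, $$B_n^+(s,t)=sB_{n-1}^+(s,t)+tB_{n-1}^-(s,t)+st\,DB_{n-1}(s,t),\qquad B_n^-(s,t)=sB_{n-1}^-(s,t)+tB_{n-1}^+(s,t)+st\,DB_{n-1}(s,t),$$ where $D=\frac{\partial}{\partial s}+\frac{\partial}{\partial t}$.
   Context: $\mathfrak{B}_n$ is the group of signed permutations: bijections $\pi$ of $\{\pm1,\dots,\pm n\}$ with $\pi(-i)=-\pi(i)$; write $\pi_i=\pi(i)$ and $\pi_0=0$. $\mathsf{inv}_B(\pi)=|\{1\le i<j\le n:\pi_i>\pi_j\}|+|\{1\le i<j\le n:-\pi_i>\pi_j\}|+|\{i\in[n]:\pi_i<0\}|$; $\mathfrak{B}_n^+$ is the set of $\pi$ with $\mathsf{inv}_B(\pi)$ even, $\mathfrak{B}_n^-=\mathfrak{B}_n\setminus\mathfrak{B}_n^+$. $\mathsf{des}_B(\pi)=|\{i\in\{0,\dots,n-1\}:\pi_i>\pi_{i+1}\}|$, $\mathsf{asc}_B(\pi)=|\{i\in\{0,\dots,n-1\}:\pi_i<\pi_{i+1}\}|$. $B_n(s,t)=\sum_{\pi\in\mathfrak{B}_n}t^{\mathsf{des}_B(\pi)}s^{\mathsf{asc}_B(\pi)}$, $B_n^{\pm}(s,t)=\sum_{\pi\in\mathfrak{B}_n^{\pm}}t^{\mathsf{des}_B(\pi)}s^{\mathsf{asc}_B(\pi)}$. -}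

module Defs where

open import Data.Bool using (Bool; true; false; not; _∧_; if_then_else_)
open import Data.Nat as ℕ using (ℕ; zero; suc; _+_; _*_; _∸_; _≡ᵇ_; _%_)
open import Data.Integer as ℤ using (ℤ; +_; -[1+_]; ∣_∣; -_; _<?_)
open import Data.List using (List; []; _∷_; map; concatMap; upTo; length; filterᵇ; _++_)
open import Data.Bool.ListAction using (any)
open import Relation.Nullary.Decidable using (⌊_⌋)
open import Relation.Binary.PropositionalEquality using (_≡_)

-- Signed permutations of [n], in window notation [π₁, …, πₙ].
-- A signed permutation π is determined by its window; the windows are
-- exactly the lists of length n with entries in {±1,…,±n} whose
-- absolute values are pairwise distinct.

signedVals : ℕ → List ℤ
signedVals n = map (λ k → + suc k) (upTo n) ++ map -[1+_] (upTo n)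

words : List ℤ → ℕ → List (List ℤ)
words vs zero    = [] ∷ []
words vs (suc k) = concatMap (λ v → map (v ∷_) (words vs k)) vs

distinct : List ℕ → Bool
distinct []       = true
distinct (x ∷ xs) = not (any (x ≡ᵇ_) xs) ∧ distinct xs

signedPerms : ℕ → List (List ℤ)
signedPerms n = filterᵇ (λ w → distinct (map ∣_∣ w)) (words (signedVals n) n)

countᵇ : {A : Set} → (A → Bool) → List A → ℕ
countᵇ p xs = length (filterᵇ p xs)

_>ᵇ_ : ℤ → ℤ → Bool
x >ᵇ y = ⌊ y <? x ⌋
infix 4 _>ᵇ_ _<ᵇ_

_<ᵇ_ : ℤ → ℤ → Bool
x <ᵇ y = ⌊ x <? y ⌋

invB : List ℤ → ℕ
invB []       = 0
invB (x ∷ xs) =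
  countᵇ (λ y → x >ᵇ y) xs + countᵇ (λ y → (- x) >ᵇ y) xs
  + (if x <ᵇ (+ 0) then 1 else 0) + invB xs

descents : List ℤ → ℕ
descents (x ∷ y ∷ r) = (if x >ᵇ y then 1 else 0) + descents (y ∷ r)
descents _           = 0

ascents : List ℤ → ℕ
ascents (x ∷ y ∷ r) = (if x <ᵇ y then 1 else 0) + ascents (y ∷ r)
ascents _           = 0

-- with the convention π₀ = 0, positions i ∈ {0,…,n-1}
desB : List ℤ → ℕ
desB w = descents (+ 0 ∷ w)

ascB : List ℤ → ℕ
ascB w = ascents (+ 0 ∷ w)

isEven : ℕ → Bool
isEven m = m % 2 ≡ᵇ 0

-- Bivariate polynomials in s, t with natural-number coefficients,
-- represented by their coefficient function: P i j = [s^i t^j] P.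

Poly : Set
Poly = ℕ → ℕ → ℕ

_⊕_ : Poly → Poly → Poly
(P ⊕ Q) i j = P i j + Q i j
infixl 6 _⊕_

mulS : Poly → Poly
mulS P zero    j = 0
mulS P (suc i) j = P i j

mulT : Poly → Poly
mulT P i zero    = 0
mulT P i (suc j) = P i j

∂s : Poly → Poly
∂s P i j = suc i * P (suc i) j

∂t : Poly → Poly
∂t P i j = suc j * P i (suc j)

D : Poly → Poly
D P = ∂s P ⊕ ∂t P

_≈ₚ_ : Poly → Poly → Set
P ≈ₚ Q = ∀ i j → P i j ≡ Q i j
infix 4 _≈ₚ_

B : ℕ → Poly
B n i j = countᵇ (λ w → (ascB w ≡ᵇ i) ∧ (desB w ≡ᵇ j)) (signedPerms n)

B⁺ : ℕ → Poly
B⁺ n i j = countᵇ (λ w → isEven (invB w) ∧ (ascB w ≡ᵇ i) ∧ (desB w ≡ᵇ j)) (signedPerms n)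

B⁻ : ℕ → Poly
B⁻ n i j = countᵇ (λ w → not (isEven (invB w)) ∧ (ascB w ≡ᵇ i) ∧ (desB w ≡ᵇ j)) (signedPerms n)

-- Every window of 𝔅ₙ₊₁ arises in exactly one way by inserting n+1 or −(n+1) into a
-- window of 𝔅ₙ; removing the letter of absolute value n+1 undoes it, and a pigeonhole
-- argument shows that this letter is always present. Put π₀ = 0 in front. Inserting either
-- letter into one of the n gaps (πᵢ, πᵢ₊₁) turns that gap into an ascent followed by a
-- descent, and the two signs change inv_B by amounts of opposite parity. Hence each
-- ascent gap of a window with statistics (a, d) contributes s^a t^(d+1), and each descent
-- gap s^(a+1) t^d, once to B⁺ₙ₊₁ and once to B⁻ₙ₊₁; summed over 𝔅ₙ this is st·DBₙ. At the
-- end of the window, n+1 adds an ascent and keeps the parity of inv_B while −(n+1) adds a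
-- descent and flips it, which gives the terms sB^±ₙ and tB^∓ₙ.
module Submission where

open import Defs

open import Axiom.UniquenessOfIdentityProofs using (module Decidable⇒UIP)
open import Data.Bool as Bool using (Bool; true; false; not; _∧_; T; if_then_else_)
open import Data.Bool.ListAction using (any)
import Data.Bool.Properties as Boolₚ
open import Data.Empty using (⊥-elim)
open import Data.Integer as ℤ using (ℤ; +_; -[1+_]; ∣_∣; -_)
import Data.Integer.Properties as ℤₚ
open import Data.List using (List; []; _∷_; map; concatMap; length; filter; filterᵇ; upTo; _++_)
open import Data.List.Membership.Propositional using (_∈_; find; lose)
open import Data.List.Membership.Propositional.Properties
  using (∈-map⁻; ∈-map⁺; ∈-concatMap⁻; ∈-concatMap⁺; ∈-filter⁻; ∈-filter⁺;
         ∈-++⁻; ∈-++⁺ˡ; ∈-++⁺ʳ; ∈-upTo⁻; ∈-upTo⁺)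
import Data.List.Membership.Setoid.Properties as Membershipₚ
open import Data.List.Properties
  using (≡-dec; length-map; length-++; map-cong-local; filter-++; filter-all; filter-accept; filter-reject;
         ∷-injectiveˡ; ∷-injectiveʳ)
open import Data.List.Relation.Binary.BagAndSetEquality using (∼bag⇒↭)
open import Data.List.Relation.Binary.Disjoint.Propositional using (Disjoint)
open import Data.List.Relation.Binary.Permutation.Propositional
  using (_↭_; ↭-refl; ↭-sym; ↭-trans; prep; swap; ↭⇒↭ₛ)
open import Data.List.Relation.Binary.Permutation.Propositional.Properties
  using (↭-length; filter-↭; All-resp-↭; map⁺)
import Data.List.Relation.Binary.Permutation.Setoid.Properties as Permutationₛₚ
open import Data.List.Relation.Unary.All as All using (All; []; _∷_)
import Data.List.Relation.Unary.All.Properties as Allₚ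
open import Data.List.Relation.Unary.AllPairs using ([]; _∷_)
open import Data.List.Relation.Unary.Any as Any using (here; there)
open import Data.List.Relation.Unary.Linked as Linked using (Linked; _∷_)
import Data.List.Relation.Unary.Linked.Properties as Linkedₚ
open import Data.List.Relation.Unary.Unique.Propositional using (Unique)
import Data.List.Relation.Unary.Unique.Propositional.Properties as Uniqueₚ
open import Data.Nat as ℕ using (ℕ; zero; suc; _+_; _*_; _≡ᵇ_; _≤_; _∸_; z≤n; s≤s; s≤s⁻¹; parity)
open import Data.Nat.ListAction using (sum)
import Data.Nat.Properties as ℕₚ
open import Data.Nat.Solver using (module +-*-Solver)
open import Data.Parity.Base as ℙ using (Parity; 0ℙ; 1ℙ; _⁻¹)
import Data.Parity.Properties as ℙₚ
open import Data.Product using (_×_; _,_; proj₁; proj₂; uncurry; ∃)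
open import Data.Sum using (_⊎_; inj₁; inj₂)
open import Function using (_∘_)
open import Function.Bundles using (Equivalence; mk↔ₛ′)
open import Relation.Binary.Definitions using (DecidableEquality; tri<; tri≈; tri>)
open import Relation.Binary.PropositionalEquality
open import Relation.Nullary using (Dec; ¬_; yes; no; ¬?; contradiction)
open import Relation.Nullary.Decidable using (⌊_⌋; isYes≗does; dec-true; dec-false)

open +-*-Solver using (solve; _:+_; _:*_; _:=_)

private variable
  X Y : Set

⌊⌋-true : ∀ {P : Set} (P? : Dec P) → P → ⌊ P? ⌋ ≡ true
⌊⌋-true P? p = trans (isYes≗does P?) (dec-true P? p)

⌊⌋-false : ∀ {P : Set} (P? : Dec P) → ¬ P → ⌊ P? ⌋ ≡ false
⌊⌋-false P? ¬p = trans (isYes≗does P?) (dec-false P? ¬p)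

⟦_⟧ : Bool → ℕ
⟦ b ⟧ = if b then 1 else 0

countᵇ-∷ : ∀ (p : X → Bool) x xs → countᵇ p (x ∷ xs) ≡ ⟦ p x ⟧ + countᵇ p xs
countᵇ-∷ p x xs with p x
... | true  = refl
... | false = refl

countᵇ-∷-∷ : ∀ (p : X → Bool) x y zs → countᵇ p (x ∷ y ∷ zs) ≡ ⟦ p x ⟧ + ⟦ p y ⟧ + countᵇ p zs
countᵇ-∷-∷ p x y zs = begin
  countᵇ p (x ∷ y ∷ zs)                 ≡⟨ countᵇ-∷ p x (y ∷ zs) ⟩
  ⟦ p x ⟧ + countᵇ p (y ∷ zs)           ≡⟨ cong (_+_ ⟦ p x ⟧) (countᵇ-∷ p y zs) ⟩
  ⟦ p x ⟧ + (⟦ p y ⟧ + countᵇ p zs)     ≡⟨ ℕₚ.+-assoc ⟦ p x ⟧ _ _ ⟨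
  ⟦ p x ⟧ + ⟦ p y ⟧ + countᵇ p zs       ∎
  where open ≡-Reasoning

countᵇ-++ : ∀ (p : X → Bool) xs ys → countᵇ p (xs ++ ys) ≡ countᵇ p xs + countᵇ p ys
countᵇ-++ p xs ys = trans (cong length (filter-++ (Bool.T? ∘ p) xs ys)) (length-++ (filterᵇ p xs))

countᵇ-↭ : ∀ (p : X → Bool) {xs ys} → xs ↭ ys → countᵇ p xs ≡ countᵇ p ys
countᵇ-↭ p xs↭ys = ↭-length (filter-↭ (Bool.T? ∘ p) xs↭ys)

countᵇ-cong-local : ∀ {p q : X → Bool} {xs} → All (λ x → p x ≡ q x) xs → countᵇ p xs ≡ countᵇ q xs
countᵇ-cong-local [] = refl
countᵇ-cong-local {p = p} {q} {x ∷ xs} (px≡qx ∷ eqs) = begin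
  countᵇ p (x ∷ xs)     ≡⟨ countᵇ-∷ p x xs ⟩
  ⟦ p x ⟧ + countᵇ p xs ≡⟨ cong₂ _+_ (cong ⟦_⟧ px≡qx) (countᵇ-cong-local eqs) ⟩
  ⟦ q x ⟧ + countᵇ q xs ≡⟨ countᵇ-∷ q x xs ⟨
  countᵇ q (x ∷ xs)     ∎
  where open ≡-Reasoning

countᵇ-none : ∀ {p : X → Bool} {xs} → All (λ x → p x ≡ false) xs → countᵇ p xs ≡ 0
countᵇ-none []                = refl
countᵇ-none {p = p} {x ∷ xs} (px≡false ∷ rest) =
  trans (countᵇ-∷ p x xs) (cong₂ _+_ (cong ⟦_⟧ px≡false) (countᵇ-none rest))

countᵇ-all : ∀ {p : X → Bool} {xs} → All (λ x → p x ≡ true) xs → countᵇ p xs ≡ length xs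
countᵇ-all []                = refl
countᵇ-all {p = p} {x ∷ xs} (px≡true ∷ rest) =
  trans (countᵇ-∷ p x xs) (cong₂ _+_ (cong ⟦_⟧ px≡true) (countᵇ-all rest))

countᵇ-map : ∀ (p : Y → Bool) (f : X → Y) xs → countᵇ p (map f xs) ≡ countᵇ (p ∘ f) xs
countᵇ-map p f []       = refl
countᵇ-map p f (x ∷ xs) = begin
  countᵇ p (f x ∷ map f xs)   ≡⟨ countᵇ-∷ p (f x) (map f xs) ⟩
  ⟦ p (f x) ⟧ + countᵇ p (map f xs) ≡⟨ cong (_+_ ⟦ p (f x) ⟧) (countᵇ-map p f xs) ⟩
  ⟦ p (f x) ⟧ + countᵇ (p ∘ f) xs   ≡⟨ countᵇ-∷ (p ∘ f) x xs ⟨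
  countᵇ (p ∘ f) (x ∷ xs)     ∎
  where open ≡-Reasoning

countᵇ-concatMap : ∀ (p : Y → Bool) (f : X → List Y) xs →
  countᵇ p (concatMap f xs) ≡ sum (map (countᵇ p ∘ f) xs)
countᵇ-concatMap p f []       = refl
countᵇ-concatMap p f (x ∷ xs) =
  trans (countᵇ-++ p (f x) (concatMap f xs)) (cong (_+_ (countᵇ p (f x))) (countᵇ-concatMap p f xs))

⟦∧⟧+⟦not∧⟧ : ∀ c z → ⟦ c ∧ z ⟧ + ⟦ not c ∧ z ⟧ ≡ ⟦ z ⟧
⟦∧⟧+⟦not∧⟧ true  z = ℕₚ.+-identityʳ ⟦ z ⟧
⟦∧⟧+⟦not∧⟧ false z = refl

sum-map-+ : ∀ (f g : X → ℕ) xs → sum (map (λ x → f x + g x) xs) ≡ sum (map f xs) + sum (map g xs)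
sum-map-+ f g []       = refl
sum-map-+ f g (x ∷ xs) rewrite sum-map-+ f g xs =
  solve 4 (λ a b c d → (a :+ b) :+ (c :+ d) := (a :+ c) :+ (b :+ d)) refl (f x) (g x) (sum (map f xs)) (sum (map g xs))

sum-map-Iverson : ∀ (p : X → Bool) xs → sum (map (⟦_⟧ ∘ p) xs) ≡ countᵇ p xs
sum-map-Iverson p []       = refl
sum-map-Iverson p (x ∷ xs) = trans (cong (_+_ ⟦ p x ⟧) (sum-map-Iverson p xs)) (sym (countᵇ-∷ p x xs))

sum-map-*-Iverson : ∀ (f : X → ℕ) (p : X → Bool) k → (∀ x → T (p x) → f x ≡ k) →
  ∀ xs → sum (map (λ x → f x * ⟦ p x ⟧) xs) ≡ k * countᵇ p xs
sum-map-*-Iverson f p k f≡k []       = sym (ℕₚ.*-zeroʳ k)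
sum-map-*-Iverson f p k f≡k (x ∷ xs) = begin
  f x * ⟦ p x ⟧ + sum (map (λ x → f x * ⟦ p x ⟧) xs) ≡⟨ cong₂ _+_ term (sum-map-*-Iverson f p k f≡k xs) ⟩
  k * ⟦ p x ⟧ + k * countᵇ p xs                     ≡⟨ ℕₚ.*-distribˡ-+ k _ _ ⟨
  k * (⟦ p x ⟧ + countᵇ p xs)                       ≡⟨ cong (k *_) (countᵇ-∷ p x xs) ⟨
  k * countᵇ p (x ∷ xs)                             ∎
  where
  open ≡-Reasoning
  term : f x * ⟦ p x ⟧ ≡ k * ⟦ p x ⟧
  term with p x in px
  ... | true  = cong (_* 1) (f≡k x (subst T (sym px) _))
  ... | false = trans (ℕₚ.*-zeroʳ (f x)) (sym (ℕₚ.*-zeroʳ k))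

Unique-resp-↭ : ∀ {xs ys : List X} → xs ↭ ys → Unique xs → Unique ys
Unique-resp-↭ {X} xs↭ys = Permutationₛₚ.Unique-resp-↭ (setoid X) (↭⇒↭ₛ xs↭ys)

Unique-∼set⇒↭ : DecidableEquality X → ∀ {xs ys : List X} → Unique xs → Unique ys →
  (∀ {z} → z ∈ xs → z ∈ ys) → (∀ {z} → z ∈ ys → z ∈ xs) → xs ↭ ys
Unique-∼set⇒↭ {X} _≟_ xs! ys! to from =
  ∼bag⇒↭ (mk↔ₛ′ to from (λ _ → irrelevant ys! _ _) (λ _ → irrelevant xs! _ _))
  where irrelevant = Membershipₚ.unique⇒irrelevant (setoid X) (Decidable⇒UIP.≡-irrelevant _≟_)

Unique-concatMap⁺ : ∀ (f : X → List Y) {xs} → Unique xs → All (Unique ∘ f) xs →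
  (∀ {x x′ y} → x ∈ xs → x′ ∈ xs → y ∈ f x → y ∈ f x′ → x ≡ x′) → Unique (concatMap f xs)
Unique-concatMap⁺ f []            []           _    = []
Unique-concatMap⁺ f {x ∷ xs} (x∉ ∷ xs!) (fx! ∷ fxs!) same =
  Uniqueₚ.++⁺ fx! (Unique-concatMap⁺ f xs! fxs! (λ x∈ x′∈ → same (there x∈) (there x′∈))) disjoint
  where
  disjoint : Disjoint (f x) (concatMap f xs)
  disjoint (y∈fx , y∈rest) with find (∈-concatMap⁻ f {xs = xs} y∈rest)
  ... | x′ , x′∈ , y∈fx′ = All.lookup x∉ x′∈ (same (here refl) (there x′∈) y∈fx y∈fx′)

Unique-length≤ : ∀ m {xs : List ℕ} → Unique xs → All (λ k → 1 ≤ k × k ≤ m) xs → length xs ≤ m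
Unique-length≤ zero    {[]}     _   _                     = z≤n
Unique-length≤ zero    {x ∷ xs} _   ((1≤x , x≤0) ∷ _)     = contradiction (ℕₚ.≤-trans 1≤x x≤0) λ ()
Unique-length≤ (suc m) {xs}     xs! bounds =
  ℕₚ.≤-trans (length≤1+length-filter xs xs!)
             (s≤s (Unique-length≤ m (Uniqueₚ.filter⁺ ≢m+1? xs!) (All.tabulate bounds′)))
  where
  ≢m+1? = λ k → ¬? (k ℕ.≟ suc m)
  bounds′ : ∀ {k} → k ∈ filter ≢m+1? xs → 1 ≤ k × k ≤ m
  bounds′ k∈ with ∈-filter⁻ ≢m+1? {xs = xs} k∈
  ... | k∈xs , k≢m+1 with All.lookup bounds k∈xs
  ...   | 1≤k , k≤m+1 = 1≤k , s≤s⁻¹ (ℕₚ.≤∧≢⇒< k≤m+1 k≢m+1)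
  length≤1+length-filter : ∀ ys → Unique ys → length ys ≤ suc (length (filter ≢m+1? ys))
  length≤1+length-filter []       _          = z≤n
  length≤1+length-filter (y ∷ ys) (y∉ ∷ ys!) with y ℕ.≟ suc m
  ... | yes y≡m+1 = s≤s (ℕₚ.≤-reflexive (cong length (sym (begin
    filter ≢m+1? (y ∷ ys) ≡⟨ filter-reject ≢m+1? (λ y≢m+1 → y≢m+1 y≡m+1) ⟩
    filter ≢m+1? ys       ≡⟨ filter-all ≢m+1? (All.map (λ y≢k k≡m+1 → y≢k (trans y≡m+1 (sym k≡m+1))) y∉) ⟩
    ys                    ∎))))
    where open ≡-Reasoning
  ... | no  y≢m+1 = subst (λ l → suc (length ys) ≤ suc (length l)) (sym (filter-accept ≢m+1? y≢m+1))
                          (s≤s (length≤1+length-filter ys ys!))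

-- Coefficientwise form of st·DP = s∂ₛ(tP) + t∂ₜ(sP).
mulS-mulT-D : ∀ P i j → mulS (mulT (D P)) i j ≡ i * mulT P i j + j * mulS P i j
mulS-mulT-D P zero    j       = sym (ℕₚ.*-zeroʳ j)
mulS-mulT-D P (suc i) zero    = sym (trans (ℕₚ.+-identityʳ (suc i * 0)) (ℕₚ.*-zeroʳ (suc i)))
mulS-mulT-D P (suc i) (suc j) = refl

mulS-cong : ∀ {P Q} → P ≈ₚ Q → mulS P ≈ₚ mulS Q
mulS-cong P≈Q zero    j = refl
mulS-cong P≈Q (suc i) j = P≈Q i j

mulT-cong : ∀ {P Q} → P ≈ₚ Q → mulT P ≈ₚ mulT Q
mulT-cong P≈Q i zero    = refl
mulT-cong P≈Q i (suc j) = P≈Q i j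

ascDesPoly : (List ℤ → Bool) → List (List ℤ) → Poly
ascDesPoly p L i j = countᵇ (λ σ → p σ ∧ (ascB σ ≡ᵇ i) ∧ (desB σ ≡ᵇ j)) L

ascDesPoly-suc-asc : ∀ p L i j →
  countᵇ (λ σ → p σ ∧ (suc (ascB σ) ≡ᵇ i) ∧ (desB σ ≡ᵇ j)) L ≡ mulS (ascDesPoly p L) i j
ascDesPoly-suc-asc p L zero    j = countᵇ-none {xs = L} (All.tabulate λ {σ} _ → Boolₚ.∧-zeroʳ (p σ))
ascDesPoly-suc-asc p L (suc i) j = refl

ascDesPoly-suc-des : ∀ p L i j →
  countᵇ (λ σ → p σ ∧ (ascB σ ≡ᵇ i) ∧ (suc (desB σ) ≡ᵇ j)) L ≡ mulT (ascDesPoly p L) i j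
ascDesPoly-suc-des p L i zero    =
  countᵇ-none {xs = L} (All.tabulate λ {σ} _ →
    trans (cong (p σ ∧_) (Boolₚ.∧-zeroʳ (ascB σ ≡ᵇ i))) (Boolₚ.∧-zeroʳ (p σ)))
ascDesPoly-suc-des p L i (suc j) = refl

sum-asc-weighted : ∀ L i j →
  sum (map (λ σ → ascB σ * ⟦ (ascB σ ≡ᵇ i) ∧ (suc (desB σ) ≡ᵇ j) ⟧) L)
  ≡ i * mulT (ascDesPoly (λ _ → true) L) i j
sum-asc-weighted L i j = trans
  (sum-map-*-Iverson ascB _ i (λ σ t → ℕₚ.≡ᵇ⇒≡ _ _ (proj₁ (Equivalence.to Boolₚ.T-∧ t))) L)
  (cong (i *_) (ascDesPoly-suc-des (λ _ → true) L i j))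

sum-des-weighted : ∀ L i j →
  sum (map (λ σ → desB σ * ⟦ (suc (ascB σ) ≡ᵇ i) ∧ (desB σ ≡ᵇ j) ⟧) L)
  ≡ j * mulS (ascDesPoly (λ _ → true) L) i j
sum-des-weighted L i j = trans
  (sum-map-*-Iverson desB _ j (λ σ t → ℕₚ.≡ᵇ⇒≡ _ _ (proj₂ (Equivalence.to Boolₚ.T-∧ t))) L)
  (cong (j *_) (ascDesPoly-suc-asc (λ _ → true) L i j))

isEven≡parity≟0ℙ : ∀ m → isEven m ≡ ⌊ parity m ℙₚ.≟ 0ℙ ⌋
isEven≡parity≟0ℙ zero          = refl
isEven≡parity≟0ℙ (suc zero)    = refl
isEven≡parity≟0ℙ (suc (suc m)) = isEven≡parity≟0ℙ m

not-≟ : ∀ q e → not ⌊ q ℙₚ.≟ e ⌋ ≡ ⌊ q ℙₚ.≟ e ⁻¹ ⌋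
not-≟ 0ℙ 0ℙ = refl
not-≟ 0ℙ 1ℙ = refl
not-≟ 1ℙ 0ℙ = refl
not-≟ 1ℙ 1ℙ = refl

+-≟ : ∀ c q e → ⌊ c ℙ.+ q ℙₚ.≟ e ⌋ ≡ ⌊ q ℙₚ.≟ c ℙ.+ e ⌋
+-≟ 0ℙ q  e  = refl
+-≟ 1ℙ 0ℙ 0ℙ = refl
+-≟ 1ℙ 0ℙ 1ℙ = refl
+-≟ 1ℙ 1ℙ 0ℙ = refl
+-≟ 1ℙ 1ℙ 1ℙ = refl

parity-suc : ∀ m → parity (suc m) ≡ parity m ⁻¹
parity-suc zero          = refl
parity-suc (suc zero)    = refl
parity-suc (suc (suc m)) = parity-suc m

parity-suc+suc : ∀ m n k → parity (suc m + suc n + k) ≡ parity (m + n + k)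
parity-suc+suc m n k = cong (λ l → parity (suc l + k)) (ℕₚ.+-suc m n)

hasParity : Parity → List ℤ → Bool
hasParity e w = ⌊ parity (invB w) ℙₚ.≟ e ⌋

headInv : ℤ → List ℤ → ℕ
headInv x xs = countᵇ (λ y → x >ᵇ y) xs + countᵇ (λ y → (- x) >ᵇ y) xs + ⟦ x <ᵇ + 0 ⟧

hasParity-∷ : ∀ e x w → hasParity e (x ∷ w) ≡ hasParity (parity (headInv x w) ℙ.+ e) w
hasParity-∷ e x w =
  trans (cong (λ q → ⌊ q ℙₚ.≟ e ⌋) (ℙₚ.+-homo-+ (headInv x w) (invB w)))
        (+-≟ (parity (headInv x w)) (parity (invB w)) e)

headInv-∷ : ∀ y z r → headInv y (z ∷ r) ≡
  (⟦ z <ᵇ y ⟧ + countᵇ (λ x → y >ᵇ x) r) + (⟦ z <ᵇ - y ⟧ + countᵇ (λ x → (- y) >ᵇ x) r) + ⟦ y <ᵇ + 0 ⟧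
headInv-∷ y z r =
  cong₂ (λ a b → a + b + ⟦ y <ᵇ + 0 ⟧) (countᵇ-∷ (λ x → y >ᵇ x) z r) (countᵇ-∷ (λ x → (- y) >ᵇ x) z r)

headInv-↭ : ∀ y {w w′} → w ↭ w′ → headInv y w ≡ headInv y w′
headInv-↭ y w↭w′ =
  cong₂ (λ a b → a + b + ⟦ y <ᵇ + 0 ⟧)
        (countᵇ-↭ (λ x → y >ᵇ x) w↭w′) (countᵇ-↭ (λ x → (- y) >ᵇ x) w↭w′)

-- A letter comparing in the same way with y and with −y adds 0 or 2 to headInv y.
parity-headInv-∷ : ∀ {y z} r → (z <ᵇ y) ≡ (z <ᵇ - y) → parity (headInv y (z ∷ r)) ≡ parity (headInv y r)
parity-headInv-∷ {y} {z} r same = trans (cong parity (headInv-∷ y z r)) (shift (z <ᵇ y) (z <ᵇ - y) same)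
  where
  c₁ = countᵇ (λ x → y >ᵇ x) r
  c₂ = countᵇ (λ x → (- y) >ᵇ x) r
  shift : ∀ b b′ → b ≡ b′ →
    parity ((⟦ b ⟧ + c₁) + (⟦ b′ ⟧ + c₂) + ⟦ y <ᵇ + 0 ⟧) ≡ parity (c₁ + c₂ + ⟦ y <ᵇ + 0 ⟧)
  shift false _ refl = refl
  shift true  _ refl = parity-suc+suc c₁ c₂ ⟦ y <ᵇ + 0 ⟧

<ᵇ-≢ : ∀ {x y} → x ≢ y → (x <ᵇ y) ≡ not (y <ᵇ x)
<ᵇ-≢ {x} {y} x≢y with ℤₚ.<-cmp x y
... | tri< x<y _ y≮x = trans (⌊⌋-true (x ℤ.<? y) x<y) (cong not (sym (⌊⌋-false (y ℤ.<? x) y≮x)))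
... | tri≈ _ x≡y _   = ⊥-elim (x≢y x≡y)
... | tri> x≮y _ y<x = trans (⌊⌋-false (x ℤ.<? y) x≮y) (cong not (sym (⌊⌋-true (y ℤ.<? x) y<x)))

ascDes : List ℤ → ℕ × ℕ
ascDes w = ascents w , descents w

-- The number of insertions of ±(n+1) into a word with A ascents and D descents that lie in a
-- given parity class and whose statistics pass Q, where c says whether the word itself lies in
-- that class: each ascent or descent gap contributes exactly one insertion to the class, and the
-- last slot gives +(n+1) (one more ascent, same parity) or −(n+1) (one more descent, other parity).
insertionWeight : (ℕ → ℕ → Bool) → ℕ → ℕ → Bool → ℕ
insertionWeight Q A D c =
  A * ⟦ Q A (suc D) ⟧ + D * ⟦ Q (suc A) D ⟧ + ⟦ c ∧ Q (suc A) D ⟧ + ⟦ not c ∧ Q A (suc D) ⟧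

-- Splitting off the first gap of the word, an ascent (u) or a descent (v).
insertionWeight-step : ∀ Q u v → u ≡ not v → ∀ A D c →
  ⟦ Q (suc A) (suc D) ⟧ + insertionWeight (λ x z → Q (⟦ u ⟧ + x) (⟦ v ⟧ + z)) A D c
  ≡ insertionWeight Q (⟦ u ⟧ + A) (⟦ v ⟧ + D) c
insertionWeight-step Q _ false refl A D c =
  solve 6 (λ q a d x y z → q :+ (a :* q :+ d :* x :+ y :+ z) := (q :+ a :* q) :+ d :* x :+ y :+ z) refl
    ⟦ Q (suc A) (suc D) ⟧ A D ⟦ Q (suc (suc A)) D ⟧ ⟦ c ∧ Q (suc (suc A)) D ⟧ ⟦ not c ∧ Q (suc A) (suc D) ⟧
insertionWeight-step Q _ true refl A D c =
  solve 6 (λ q a d x y z → q :+ (a :* x :+ d :* q :+ y :+ z) := a :* x :+ (q :+ d :* q) :+ y :+ z) refl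
    ⟦ Q (suc A) (suc D) ⟧ A D ⟦ Q A (suc (suc D)) ⟧ ⟦ c ∧ Q (suc A) (suc D) ⟧ ⟦ not c ∧ Q A (suc (suc D)) ⟧

Letter : ℕ → ℤ → Set
Letter n z = 1 ≤ ∣ z ∣ × ∣ z ∣ ≤ n

IsSignedPerm : ℕ → List ℤ → Set
IsSignedPerm n w = length w ≡ n × All (Letter n) w × Unique (map ∣_∣ w)

∈-signedVals⁻ : ∀ n {z} → z ∈ signedVals n → Letter n z
∈-signedVals⁻ n z∈ with ∈-++⁻ (map (λ k → + suc k) (upTo n)) z∈
... | inj₁ z∈⁺ with ∈-map⁻ (λ k → + suc k) z∈⁺
...   | k , k∈ , refl = s≤s z≤n , ∈-upTo⁻ k∈
∈-signedVals⁻ n z∈ | inj₂ z∈⁻ with ∈-map⁻ -[1+_] z∈⁻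
...   | k , k∈ , refl = s≤s z≤n , ∈-upTo⁻ k∈

∈-signedVals⁺ : ∀ n {z} → Letter n z → z ∈ signedVals n
∈-signedVals⁺ n {+ suc k}  (_ , k<n) = ∈-++⁺ˡ (∈-map⁺ (λ k → + suc k) (∈-upTo⁺ k<n))
∈-signedVals⁺ n { -[1+ k ]} (_ , k<n) = ∈-++⁺ʳ (map (λ k → + suc k) (upTo n)) (∈-map⁺ -[1+_] (∈-upTo⁺ k<n))

signedVals-Unique : ∀ n → Unique (signedVals n)
signedVals-Unique n =
  Uniqueₚ.++⁺ (Uniqueₚ.map⁺ (λ { refl → refl }) (Uniqueₚ.upTo⁺ n))
              (Uniqueₚ.map⁺ (λ { refl → refl }) (Uniqueₚ.upTo⁺ n)) disjoint
  where
  disjoint : Disjoint (map (λ k → + suc k) (upTo n)) (map -[1+_] (upTo n))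
  disjoint (z∈⁺ , z∈⁻) with ∈-map⁻ (λ k → + suc k) z∈⁺ | ∈-map⁻ -[1+_] z∈⁻
  ... | _ , _ , refl | _ , _ , ()

∈-words⁻ : ∀ vs k {w} → w ∈ words vs k → length w ≡ k × All (_∈ vs) w
∈-words⁻ vs zero    (here refl) = refl , []
∈-words⁻ vs (suc k) w∈ with find (∈-concatMap⁻ (λ v → map (v ∷_) (words vs k)) {xs = vs} w∈)
... | v , v∈ , w∈′ with ∈-map⁻ (v ∷_) w∈′
...   | w′ , w′∈ , refl with ∈-words⁻ vs k w′∈
...     | len , w′⊆vs = cong suc len , v∈ ∷ w′⊆vs

∈-words⁺ : ∀ vs {w} → All (_∈ vs) w → w ∈ words vs (length w)
∈-words⁺ vs []            = here refl
∈-words⁺ vs {v ∷ w} (v∈ ∷ w⊆vs) =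
  ∈-concatMap⁺ (λ v → map (v ∷_) (words vs (length w))) {xs = vs} (lose v∈ (∈-map⁺ (v ∷_) (∈-words⁺ vs w⊆vs)))

words-Unique : ∀ vs k → Unique vs → Unique (words vs k)
words-Unique vs zero    vs! = [] ∷ []
words-Unique vs (suc k) vs! =
  Unique-concatMap⁺ (λ v → map (v ∷_) (words vs k)) vs!
    (All.tabulate λ _ → Uniqueₚ.map⁺ ∷-injectiveʳ (words-Unique vs k vs!)) same-head
  where
  same-head : ∀ {v v′ w} → v ∈ vs → v′ ∈ vs →
    w ∈ map (v ∷_) (words vs k) → w ∈ map (v′ ∷_) (words vs k) → v ≡ v′
  same-head _ _ w∈ w∈′ with ∈-map⁻ _ w∈ | ∈-map⁻ _ w∈′
  ... | _ , _ , refl | _ , _ , eq = ∷-injectiveˡ eq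

fresh⇒All≢ : ∀ x ys → T (not (any (x ≡ᵇ_) ys)) → All (x ≢_) ys
fresh⇒All≢ x []       _ = []
fresh⇒All≢ x (y ∷ ys) t with x ≡ᵇ y in x≡ᵇy
... | true  = ⊥-elim t
... | false = (λ x≡y → subst T x≡ᵇy (ℕₚ.≡⇒≡ᵇ x y x≡y)) ∷ fresh⇒All≢ x ys t

All≢⇒fresh : ∀ x ys → All (x ≢_) ys → T (not (any (x ≡ᵇ_) ys))
All≢⇒fresh x []       []           = _
All≢⇒fresh x (y ∷ ys) (x≢y ∷ x∉ys) with x ≡ᵇ y in x≡ᵇy
... | true  = x≢y (ℕₚ.≡ᵇ⇒≡ x y (subst T (sym x≡ᵇy) _))
... | false = All≢⇒fresh x ys x∉ys

distinct⇒Unique : ∀ xs → T (distinct xs) → Unique xs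
distinct⇒Unique []       _ = []
distinct⇒Unique (x ∷ xs) t with Equivalence.to Boolₚ.T-∧ t
... | fresh , rest = fresh⇒All≢ x xs fresh ∷ distinct⇒Unique xs rest

Unique⇒distinct : ∀ xs → Unique xs → T (distinct xs)
Unique⇒distinct []       _          = _
Unique⇒distinct (x ∷ xs) (x∉ ∷ xs!) = Equivalence.from Boolₚ.T-∧ (All≢⇒fresh x xs x∉ , Unique⇒distinct xs xs!)

distinct∣∣? : (w : List ℤ) → Dec (T (distinct (map ∣_∣ w)))
distinct∣∣? w = Bool.T? (distinct (map ∣_∣ w))

∈-signedPerms⁻ : ∀ n {w} → w ∈ signedPerms n → IsSignedPerm n w
∈-signedPerms⁻ n w∈ with ∈-filter⁻ distinct∣∣? {xs = words (signedVals n) n} w∈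
... | w∈words , t with ∈-words⁻ (signedVals n) n w∈words
...   | len , w⊆vals = len , All.map (∈-signedVals⁻ n) w⊆vals , distinct⇒Unique _ t

∈-signedPerms⁺ : ∀ n {w} → IsSignedPerm n w → w ∈ signedPerms n
∈-signedPerms⁺ n (refl , letters , ∣w∣!) =
  ∈-filter⁺ distinct∣∣? (∈-words⁺ (signedVals n) (All.map (∈-signedVals⁺ n) letters)) (Unique⇒distinct _ ∣w∣!)

signedPerms-Unique : ∀ n → Unique (signedPerms n)
signedPerms-Unique n = Uniqueₚ.filter⁺ distinct∣∣? (words-Unique (signedVals n) n (signedVals-Unique n))

Linked≢-0∷ : ∀ {n σ} → All (Letter n) σ → Unique (map ∣_∣ σ) → Linked _≢_ (+ 0 ∷ σ)
Linked≢-0∷ letters ∣σ∣! =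
  Linked.map (λ ∣x∣≢∣y∣ x≡y → ∣x∣≢∣y∣ (cong ∣_∣ x≡y))
             (Linkedₚ.map⁻ (Linkedₚ.AllPairs⇒Linked (0∉ ∷ ∣σ∣!)))
  where 0∉ = Allₚ.map⁺ (All.map (λ (1≤∣z∣ , _) 0≡∣z∣ → ℕₚ.<-irrefl 0≡∣z∣ 1≤∣z∣) letters)

module TopInsertion (n : ℕ) where

  top⁺ top⁻ : ℤ
  top⁺ = + suc n
  top⁻ = -[1+ n ]

  Small : ℤ → Set
  Small z = ∣ z ∣ ≤ n

  Small-neg : ∀ {z} → Small z → Small (- z)
  Small-neg {z} = subst (_≤ n) (sym (ℤₚ.∣-i∣≡∣i∣ z))

  <top⁺ : ∀ {z} → Small z → z ℤ.< top⁺
  <top⁺ {+ m}      m≤n = ℤ.+<+ (s≤s m≤n)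
  <top⁺ { -[1+ m ]} _   = ℤ.-<+

  top⁻< : ∀ {z} → Small z → top⁻ ℤ.< z
  top⁻< {+ m}      _   = ℤ.-<+
  top⁻< { -[1+ m ]} m<n = ℤ.-<- m<n

  <ᵇtop⁺ : ∀ z → Small z → (z <ᵇ top⁺) ≡ true
  <ᵇtop⁺ z s = ⌊⌋-true (z ℤ.<? top⁺) (<top⁺ s)

  top⁺≮ᵇ : ∀ z → Small z → (top⁺ <ᵇ z) ≡ false
  top⁺≮ᵇ z s = ⌊⌋-false (top⁺ ℤ.<? z) (ℤₚ.<-asym (<top⁺ s))

  top⁻<ᵇ : ∀ z → Small z → (top⁻ <ᵇ z) ≡ true
  top⁻<ᵇ z s = ⌊⌋-true (top⁻ ℤ.<? z) (top⁻< s)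

  ≮ᵇtop⁻ : ∀ z → Small z → (z <ᵇ top⁻) ≡ false
  ≮ᵇtop⁻ z s = ⌊⌋-false (z ℤ.<? top⁻) (ℤₚ.<-asym (top⁻< s))

  insertTop : List ℤ → List (List ℤ)
  insertTop []      = (top⁺ ∷ []) ∷ (top⁻ ∷ []) ∷ []
  insertTop (y ∷ r) = (top⁺ ∷ y ∷ r) ∷ (top⁻ ∷ y ∷ r) ∷ map (y ∷_) (insertTop r)

  ∈-insertTop⇒↭ : ∀ r {w} → w ∈ insertTop r → w ↭ top⁺ ∷ r ⊎ w ↭ top⁻ ∷ r
  ∈-insertTop⇒↭ []      (here refl)         = inj₁ ↭-refl
  ∈-insertTop⇒↭ []      (there (here refl)) = inj₂ ↭-refl
  ∈-insertTop⇒↭ (y ∷ r) (here refl)         = inj₁ ↭-refl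
  ∈-insertTop⇒↭ (y ∷ r) (there (here refl)) = inj₂ ↭-refl
  ∈-insertTop⇒↭ (y ∷ r) (there (there w∈)) with ∈-map⁻ (y ∷_) w∈
  ... | w′ , w′∈ , refl with ∈-insertTop⇒↭ r w′∈
  ...   | inj₁ w′↭ = inj₁ (↭-trans (prep y w′↭) (swap y top⁺ ↭-refl))
  ...   | inj₂ w′↭ = inj₂ (↭-trans (prep y w′↭) (swap y top⁻ ↭-refl))

  countᵇ-top⁺>ᵇ : ∀ {l} → All Small l → countᵇ (λ y → top⁺ >ᵇ y) l ≡ length l
  countᵇ-top⁺>ᵇ sl = countᵇ-all (All.map (λ {z} → <ᵇtop⁺ z) sl)

  countᵇ-top⁻>ᵇ : ∀ {l} → All Small l → countᵇ (λ y → top⁻ >ᵇ y) l ≡ 0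
  countᵇ-top⁻>ᵇ sl = countᵇ-none (All.map (λ {z} → ≮ᵇtop⁻ z) sl)

  headInv-top⁺ : ∀ {l} → All Small l → headInv top⁺ l ≡ length l
  headInv-top⁺ {l} sl = begin
    headInv top⁺ l   ≡⟨ cong₂ (λ a b → a + b + 0) (countᵇ-top⁺>ᵇ sl) (countᵇ-top⁻>ᵇ sl) ⟩
    length l + 0 + 0 ≡⟨ trans (ℕₚ.+-identityʳ _) (ℕₚ.+-identityʳ _) ⟩
    length l         ∎
    where open ≡-Reasoning

  headInv-top⁻ : ∀ {l} → All Small l → headInv top⁻ l ≡ suc (length l)
  headInv-top⁻ {l} sl =
    trans (cong₂ (λ a b → a + b + 1) (countᵇ-top⁻>ᵇ sl) (countᵇ-top⁺>ᵇ sl)) (ℕₚ.+-comm (length l) 1)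

  hasParity-top⁻∷ : ∀ e {l} → All Small l → hasParity e (top⁻ ∷ l) ≡ not (hasParity e (top⁺ ∷ l))
  hasParity-top⁻∷ e {l} sl rewrite headInv-top⁻ sl | headInv-top⁺ sl =
    trans (cong (λ q → ⌊ q ℙₚ.≟ e ⌋) (parity-suc m)) (trans (+-≟ 1ℙ (parity m) e) (sym (not-≟ (parity m) e)))
    where m = length l + invB l

  parity-headInv-insertTop : ∀ {y} → Small y → ∀ r {w} → w ∈ insertTop r →
    parity (headInv y w) ≡ parity (headInv y r)
  parity-headInv-insertTop {y} sy r w∈ with ∈-insertTop⇒↭ r w∈
  ... | inj₁ w↭ = trans (cong parity (headInv-↭ y w↭))
                        (parity-headInv-∷ r (trans (top⁺≮ᵇ y sy) (sym (top⁺≮ᵇ (- y) (Small-neg {y} sy)))))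
  ... | inj₂ w↭ = trans (cong parity (headInv-↭ y w↭))
                        (parity-headInv-∷ r (trans (top⁻<ᵇ y sy) (sym (top⁻<ᵇ (- y) (Small-neg {y} sy)))))

  ascDes-top⁺-end : ∀ p → Small p → ascDes (p ∷ top⁺ ∷ []) ≡ (1 , 0)
  ascDes-top⁺-end p sp = cong₂ (λ a d → ⟦ a ⟧ + 0 , ⟦ d ⟧ + 0) (<ᵇtop⁺ p sp) (top⁺≮ᵇ p sp)

  ascDes-top⁻-end : ∀ p → Small p → ascDes (p ∷ top⁻ ∷ []) ≡ (0 , 1)
  ascDes-top⁻-end p sp = cong₂ (λ a d → ⟦ a ⟧ + 0 , ⟦ d ⟧ + 0) (≮ᵇtop⁻ p sp) (top⁻<ᵇ p sp)

  ascDes-top⁺-gap : ∀ p y r → Small p → Small y →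
    ascDes (p ∷ top⁺ ∷ y ∷ r) ≡ (suc (ascents (y ∷ r)) , suc (descents (y ∷ r)))
  ascDes-top⁺-gap p y r sp sy =
    cong₂ (λ (a₁ , a₂) (d₁ , d₂) → ⟦ a₁ ⟧ + (⟦ a₂ ⟧ + ascents (y ∷ r)) , ⟦ d₁ ⟧ + (⟦ d₂ ⟧ + descents (y ∷ r)))
      (cong₂ _,_ (<ᵇtop⁺ p sp) (top⁺≮ᵇ y sy)) (cong₂ _,_ (top⁺≮ᵇ p sp) (<ᵇtop⁺ y sy))

  ascDes-top⁻-gap : ∀ p y r → Small p → Small y →
    ascDes (p ∷ top⁻ ∷ y ∷ r) ≡ (suc (ascents (y ∷ r)) , suc (descents (y ∷ r)))
  ascDes-top⁻-gap p y r sp sy =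
    cong₂ (λ (a₁ , a₂) (d₁ , d₂) → ⟦ a₁ ⟧ + (⟦ a₂ ⟧ + ascents (y ∷ r)) , ⟦ d₁ ⟧ + (⟦ d₂ ⟧ + descents (y ∷ r)))
      (cong₂ _,_ (≮ᵇtop⁻ p sp) (top⁻<ᵇ y sy)) (cong₂ _,_ (top⁻<ᵇ p sp) (≮ᵇtop⁻ y sy))

  selects : Parity → (ℕ → ℕ → Bool) → ℤ → List ℤ → Bool
  selects e Q p w = hasParity e w ∧ uncurry Q (ascDes (p ∷ w))

  countᵇ-insertTop : ∀ e Q p r → All Small (p ∷ r) → Linked _≢_ (p ∷ r) →
    countᵇ (selects e Q p) (insertTop r) ≡ insertionWeight Q (ascents (p ∷ r)) (descents (p ∷ r)) (hasParity e r)
  countᵇ-insertTop e Q p [] (sp ∷ []) _ = begin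
    countᵇ (selects e Q p) (insertTop [])
      ≡⟨ countᵇ-∷-∷ (selects e Q p) (top⁺ ∷ []) (top⁻ ∷ []) [] ⟩
    ⟦ selects e Q p (top⁺ ∷ []) ⟧ + ⟦ selects e Q p (top⁻ ∷ []) ⟧ + 0
      ≡⟨ ℕₚ.+-identityʳ _ ⟩
    ⟦ selects e Q p (top⁺ ∷ []) ⟧ + ⟦ selects e Q p (top⁻ ∷ []) ⟧
      ≡⟨ cong₂ (λ a b → ⟦ a ⟧ + ⟦ b ⟧)
           (cong (hasParity e (top⁺ ∷ []) ∧_) (cong (uncurry Q) (ascDes-top⁺-end p sp)))
           (cong₂ _∧_ (hasParity-top⁻∷ e []) (cong (uncurry Q) (ascDes-top⁻-end p sp))) ⟩
    ⟦ hasParity e [] ∧ Q 1 0 ⟧ + ⟦ not (hasParity e []) ∧ Q 0 1 ⟧ ∎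
    where open ≡-Reasoning
  countᵇ-insertTop e Q p (y ∷ r) (sp ∷ sy ∷ sr) (p≢y ∷ linked) = begin
    countᵇ (selects e Q p) (insertTop l)
      ≡⟨ countᵇ-∷-∷ (selects e Q p) (top⁺ ∷ l) (top⁻ ∷ l) _ ⟩
    ⟦ selects e Q p (top⁺ ∷ l) ⟧ + ⟦ selects e Q p (top⁻ ∷ l) ⟧ + countᵇ (selects e Q p) (map (y ∷_) (insertTop r))
      ≡⟨ cong₂ _+_ gap rest ⟩
    ⟦ Q (suc A′) (suc D′) ⟧ + insertionWeight Q′ A′ D′ (hasParity e l)
      ≡⟨ insertionWeight-step Q (p <ᵇ y) (y <ᵇ p) (<ᵇ-≢ p≢y) A′ D′ _ ⟩
    insertionWeight Q (ascents (p ∷ l)) (descents (p ∷ l)) (hasParity e l) ∎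
    where
    open ≡-Reasoning
    l = y ∷ r
    A′ = ascents l
    D′ = descents l
    Q′ : ℕ → ℕ → Bool
    Q′ x z = Q (⟦ p <ᵇ y ⟧ + x) (⟦ y <ᵇ p ⟧ + z)
    c = parity (headInv y r)

    gap : ⟦ selects e Q p (top⁺ ∷ l) ⟧ + ⟦ selects e Q p (top⁻ ∷ l) ⟧ ≡ ⟦ Q (suc A′) (suc D′) ⟧
    gap = trans (cong₂ (λ a b → ⟦ a ⟧ + ⟦ b ⟧)
                  (cong (hasParity e (top⁺ ∷ l) ∧_) (cong (uncurry Q) (ascDes-top⁺-gap p y r sp sy)))
                  (cong₂ _∧_ (hasParity-top⁻∷ e {l} (sy ∷ sr)) (cong (uncurry Q) (ascDes-top⁻-gap p y r sp sy))))
                (⟦∧⟧+⟦not∧⟧ (hasParity e (top⁺ ∷ l)) _)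

    shifted : ∀ {w} → w ∈ insertTop r → selects e Q p (y ∷ w) ≡ selects (c ℙ.+ e) Q′ y w
    shifted {w} w∈ = cong (_∧ Q′ (ascents (y ∷ w)) (descents (y ∷ w)))
      (trans (hasParity-∷ e y w) (cong (λ c′ → hasParity (c′ ℙ.+ e) w) (parity-headInv-insertTop sy r w∈)))

    rest : countᵇ (selects e Q p) (map (y ∷_) (insertTop r)) ≡ insertionWeight Q′ A′ D′ (hasParity e l)
    rest = begin
      countᵇ (selects e Q p) (map (y ∷_) (insertTop r)) ≡⟨ countᵇ-map (selects e Q p) (y ∷_) (insertTop r) ⟩
      countᵇ (selects e Q p ∘ (y ∷_)) (insertTop r)     ≡⟨ countᵇ-cong-local (All.tabulate shifted) ⟩
      countᵇ (selects (c ℙ.+ e) Q′ y) (insertTop r)      ≡⟨ countᵇ-insertTop (c ℙ.+ e) Q′ y r (sy ∷ sr) linked ⟩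
      insertionWeight Q′ A′ D′ (hasParity (c ℙ.+ e) r)   ≡⟨ cong (insertionWeight Q′ A′ D′) (hasParity-∷ e y r) ⟨
      insertionWeight Q′ A′ D′ (hasParity e l)           ∎

  Small⇒∣∣≢1+n : ∀ z → Small z → ∣ z ∣ ≢ suc n
  Small⇒∣∣≢1+n _ ∣z∣≤n ∣z∣≡1+n = ℕₚ.<-irrefl refl (subst (_≤ n) ∣z∣≡1+n ∣z∣≤n)

  ∣∣≡1+n⇒top : ∀ z → ∣ z ∣ ≡ suc n → z ≡ top⁺ ⊎ z ≡ top⁻
  ∣∣≡1+n⇒top (+ _)      refl = inj₁ refl
  ∣∣≡1+n⇒top -[1+ _ ] refl = inj₂ refl

  top⁺∷∈insertTop : ∀ r → (top⁺ ∷ r) ∈ insertTop r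
  top⁺∷∈insertTop []      = here refl
  top⁺∷∈insertTop (_ ∷ _) = here refl

  top⁻∷∈insertTop : ∀ r → (top⁻ ∷ r) ∈ insertTop r
  top⁻∷∈insertTop []      = there (here refl)
  top⁻∷∈insertTop (_ ∷ _) = there (here refl)

  notTop? : (z : ℤ) → Dec (∣ z ∣ ≢ suc n)
  notTop? z = ¬? (∣ z ∣ ℕ.≟ suc n)

  removeTop : List ℤ → List ℤ
  removeTop = filter notTop?

  removeTop-top∷ : ∀ t r → ∣ t ∣ ≡ suc n → All Small r → removeTop (t ∷ r) ≡ r
  removeTop-top∷ t r ∣t∣≡1+n sr =
    trans (filter-reject notTop? {t} {r} (λ ∣t∣≢1+n → ∣t∣≢1+n ∣t∣≡1+n))
          (filter-all notTop? (All.map (λ {z} → Small⇒∣∣≢1+n z) sr))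

  removeTop-insertTop : ∀ r → All Small r → ∀ {w} → w ∈ insertTop r → removeTop w ≡ r
  removeTop-insertTop []      sr        (here refl)         = removeTop-top∷ top⁺ [] refl sr
  removeTop-insertTop []      sr        (there (here refl)) = removeTop-top∷ top⁻ [] refl sr
  removeTop-insertTop (y ∷ r) sr        (here refl)         = removeTop-top∷ top⁺ (y ∷ r) refl sr
  removeTop-insertTop (y ∷ r) sr        (there (here refl)) = removeTop-top∷ top⁻ (y ∷ r) refl sr
  removeTop-insertTop (y ∷ r) (sy ∷ sr) (there (there w∈)) with ∈-map⁻ (y ∷_) w∈
  ... | w′ , w′∈ , refl =
    trans (filter-accept notTop? {y} {w′} (Small⇒∣∣≢1+n y sy)) (cong (y ∷_) (removeTop-insertTop r sr w′∈))

  insertTop-Unique : ∀ r → All Small r → Unique (insertTop r)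
  insertTop-Unique []      _         = ((λ ()) ∷ []) ∷ [] ∷ []
  insertTop-Unique (y ∷ r) (sy ∷ sr) =
    ((λ ()) ∷ All.tabulate (top≢ top⁺ refl)) ∷ All.tabulate (top≢ top⁻ refl) ∷
    Uniqueₚ.map⁺ ∷-injectiveʳ (insertTop-Unique r sr)
    where
    top≢ : ∀ t → ∣ t ∣ ≡ suc n → ∀ {v} → v ∈ map (y ∷_) (insertTop r) → t ∷ y ∷ r ≢ v
    top≢ t ∣t∣≡1+n v∈ eq with ∈-map⁻ (y ∷_) v∈
    ... | _ , _ , refl = Small⇒∣∣≢1+n y sy (trans (cong ∣_∣ (sym (∷-injectiveˡ eq))) ∣t∣≡1+n)

  ∈-insertTop-removeTop : ∀ w → Unique (map ∣_∣ w) → ∀ {x} → x ∈ w → ∣ x ∣ ≡ suc n →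
    w ∈ insertTop (removeTop w)
  ∈-insertTop-removeTop (z ∷ w) (z∉ ∷ w!) {x} x∈ ∣x∣≡1+n with ∣ z ∣ ℕ.≟ suc n
  ... | yes ∣z∣≡1+n = subst (λ σ → z ∷ w ∈ insertTop σ) (sym removeTop≡w) (top∷∈ (∣∣≡1+n⇒top z ∣z∣≡1+n))
    where
    removeTop≡w : removeTop (z ∷ w) ≡ w
    removeTop≡w = trans (filter-reject notTop? {z} {w} (λ ≢ → ≢ ∣z∣≡1+n))
                        (filter-all notTop? (All.map (λ ∣z∣≢ ≡1+n → ∣z∣≢ (trans ∣z∣≡1+n (sym ≡1+n)))
                                                     (Allₚ.map⁻ z∉)))
    top∷∈ : z ≡ top⁺ ⊎ z ≡ top⁻ → z ∷ w ∈ insertTop w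
    top∷∈ (inj₁ refl) = top⁺∷∈insertTop w
    top∷∈ (inj₂ refl) = top⁻∷∈insertTop w
  ... | no ∣z∣≢1+n = subst (λ σ → z ∷ w ∈ insertTop σ) (sym (filter-accept notTop? {z} {w} ∣z∣≢1+n))
                           (there (there (∈-map⁺ (z ∷_) (∈-insertTop-removeTop w w! (x∈w x∈) ∣x∣≡1+n))))
    where
    x∈w : x ∈ z ∷ w → x ∈ w
    x∈w (here x≡z) = contradiction (trans (cong ∣_∣ (sym x≡z)) ∣x∣≡1+n) ∣z∣≢1+n
    x∈w (there x∈) = x∈

  IsSignedPerm-↭ : ∀ {k w w′} → w ↭ w′ → IsSignedPerm k w′ → IsSignedPerm k w
  IsSignedPerm-↭ w↭w′ (len , letters , ∣w′∣!) =
    trans (↭-length w↭w′) len ,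
    All-resp-↭ (↭-sym w↭w′) letters ,
    Unique-resp-↭ (map⁺ ∣_∣ (↭-sym w↭w′)) ∣w′∣!

  IsSignedPerm-top∷ : ∀ {t σ} → ∣ t ∣ ≡ suc n → IsSignedPerm n σ → IsSignedPerm (suc n) (t ∷ σ)
  IsSignedPerm-top∷ ∣t∣≡1+n (len , letters , ∣σ∣!) =
    cong suc len ,
    ((subst (1 ≤_) (sym ∣t∣≡1+n) (s≤s z≤n) , ℕₚ.≤-reflexive ∣t∣≡1+n) ∷
     All.map (λ (1≤ , ≤n) → 1≤ , ℕₚ.m≤n⇒m≤1+n ≤n) letters) ,
    Allₚ.map⁺ (All.map (λ {z} (_ , ∣z∣≤n) ∣t∣≡∣z∣ → Small⇒∣∣≢1+n z ∣z∣≤n (trans (sym ∣t∣≡∣z∣) ∣t∣≡1+n)) letters) ∷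
    ∣σ∣!

  IsSignedPerm-top∷⁻ : ∀ {t σ} → ∣ t ∣ ≡ suc n → IsSignedPerm (suc n) (t ∷ σ) → IsSignedPerm n σ
  IsSignedPerm-top∷⁻ ∣t∣≡1+n (len , _ ∷ letters , ∣t∣∉ ∷ ∣σ∣!) =
    ℕₚ.suc-injective len ,
    All.zipWith (λ ((1≤ , ≤1+n) , ∣t∣≢) →
                   1≤ , s≤s⁻¹ (ℕₚ.≤∧≢⇒< ≤1+n (λ ≡1+n → ∣t∣≢ (trans ∣t∣≡1+n (sym ≡1+n)))))
                (letters , Allₚ.map⁻ ∣t∣∉) ,
    ∣σ∣!

  top∈ : ∀ {w} → IsSignedPerm (suc n) w → ∃ λ x → x ∈ w × ∣ x ∣ ≡ suc n
  top∈ {w} (len , letters , ∣w∣!) with Any.any? (λ z → ∣ z ∣ ℕ.≟ suc n) w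
  ... | yes top-in-w = find top-in-w
  ... | no  no-top   = contradiction (Unique-length≤ n ∣w∣! (Allₚ.map⁺ small)) (ℕₚ.<⇒≱ ∣w∣>n)
    where
    small : All (λ z → 1 ≤ ∣ z ∣ × ∣ z ∣ ≤ n) w
    small = All.zipWith (λ ((1≤ , ≤1+n) , ≢1+n) → 1≤ , s≤s⁻¹ (ℕₚ.≤∧≢⇒< ≤1+n ≢1+n))
                        (letters , Allₚ.¬Any⇒All¬ w no-top)
    ∣w∣>n : n ℕ.< length (map ∣_∣ w)
    ∣w∣>n = ℕₚ.≤-reflexive (sym (trans (length-map ∣_∣ w) len))

  IsSignedPerm⇒∈-insertTop : ∀ {w} → IsSignedPerm (suc n) w →
    w ∈ insertTop (removeTop w) × IsSignedPerm n (removeTop w)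
  IsSignedPerm⇒∈-insertTop {w} w-perm@(_ , _ , ∣w∣!) with top∈ w-perm
  ... | x , x∈ , ∣x∣≡1+n = w∈ , σ-perm (∈-insertTop⇒↭ _ w∈)
    where
    w∈ = ∈-insertTop-removeTop w ∣w∣! x∈ ∣x∣≡1+n
    σ-perm : w ↭ top⁺ ∷ removeTop w ⊎ w ↭ top⁻ ∷ removeTop w → IsSignedPerm n (removeTop w)
    σ-perm (inj₁ w↭) = IsSignedPerm-top∷⁻ refl (IsSignedPerm-↭ (↭-sym w↭) w-perm)
    σ-perm (inj₂ w↭) = IsSignedPerm-top∷⁻ refl (IsSignedPerm-↭ (↭-sym w↭) w-perm)

  ∈-insertTop⇒IsSignedPerm : ∀ {σ w} → IsSignedPerm n σ → w ∈ insertTop σ → IsSignedPerm (suc n) w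
  ∈-insertTop⇒IsSignedPerm {σ} σ-perm w∈ with ∈-insertTop⇒↭ σ w∈
  ... | inj₁ w↭ = IsSignedPerm-↭ w↭ (IsSignedPerm-top∷ refl σ-perm)
  ... | inj₂ w↭ = IsSignedPerm-↭ w↭ (IsSignedPerm-top∷ refl σ-perm)

signedPerms-suc-↭ : ∀ n → signedPerms (suc n) ↭ concatMap (TopInsertion.insertTop n) (signedPerms n)
signedPerms-suc-↭ n = Unique-∼set⇒↭ (≡-dec ℤ._≟_) (signedPerms-Unique (suc n)) insertions-Unique to from
  where
  open TopInsertion n

  small : ∀ {σ} → σ ∈ signedPerms n → All Small σ
  small σ∈ = All.map proj₂ (proj₁ (proj₂ (∈-signedPerms⁻ n σ∈)))

  insertions-Unique : Unique (concatMap insertTop (signedPerms n))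
  insertions-Unique = Unique-concatMap⁺ insertTop (signedPerms-Unique n)
    (All.tabulate λ σ∈ → insertTop-Unique _ (small σ∈))
    (λ σ∈ σ′∈ w∈ w∈′ →
       trans (sym (removeTop-insertTop _ (small σ∈) w∈)) (removeTop-insertTop _ (small σ′∈) w∈′))

  to : ∀ {w} → w ∈ signedPerms (suc n) → w ∈ concatMap insertTop (signedPerms n)
  to w∈ with IsSignedPerm⇒∈-insertTop (∈-signedPerms⁻ (suc n) w∈)
  ... | w∈′ , σ-perm = ∈-concatMap⁺ insertTop (lose (∈-signedPerms⁺ n σ-perm) w∈′)

  from : ∀ {w} → w ∈ concatMap insertTop (signedPerms n) → w ∈ signedPerms (suc n)
  from w∈ with find (∈-concatMap⁻ insertTop {xs = signedPerms n} w∈)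
  ... | σ , σ∈ , w∈′ = ∈-signedPerms⁺ (suc n) (∈-insertTop⇒IsSignedPerm (∈-signedPerms⁻ n σ∈) w∈′)

ascDesPoly-insertTop : ∀ n e L → All (IsSignedPerm n) L →
  ascDesPoly (hasParity e) (concatMap (TopInsertion.insertTop n) L)
  ≈ₚ mulS (ascDesPoly (hasParity e) L) ⊕ mulT (ascDesPoly (hasParity (e ⁻¹)) L)
     ⊕ mulS (mulT (D (ascDesPoly (λ _ → true) L)))
ascDesPoly-insertTop n e L perms i j = begin
  countᵇ (selects e Q (+ 0)) (concatMap insertTop L)
    ≡⟨ countᵇ-concatMap (selects e Q (+ 0)) insertTop L ⟩
  sum (map (countᵇ (selects e Q (+ 0)) ∘ insertTop) L)
    ≡⟨ cong sum (map-cong-local (All.map weight perms)) ⟩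
  sum (map (λ σ → T₁ σ + T₂ σ + T₃ σ + T₄ σ) L)
    ≡⟨ sum-map-+ (λ σ → T₁ σ + T₂ σ + T₃ σ) T₄ L ⟩
  sum (map (λ σ → T₁ σ + T₂ σ + T₃ σ) L) + sum (map T₄ L)
    ≡⟨ cong (_+ sum (map T₄ L))
            (trans (sum-map-+ (λ σ → T₁ σ + T₂ σ) T₃ L) (cong (_+ sum (map T₃ L)) (sum-map-+ T₁ T₂ L))) ⟩
  sum (map T₁ L) + sum (map T₂ L) + sum (map T₃ L) + sum (map T₄ L)
    ≡⟨ cong₂ _+_ (cong₂ _+_ (cong₂ _+_ (sum-asc-weighted L i j) (sum-des-weighted L i j)) sum-T₃) sum-T₄ ⟩
  euler + mulS Aₑ i j + mulT Aₑ⁻¹ i j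
    ≡⟨ trans (ℕₚ.+-assoc euler _ _) (ℕₚ.+-comm euler _) ⟩
  mulS Aₑ i j + mulT Aₑ⁻¹ i j + euler
    ≡⟨ cong (_+_ (mulS Aₑ i j + mulT Aₑ⁻¹ i j)) (mulS-mulT-D B′ i j) ⟨
  mulS Aₑ i j + mulT Aₑ⁻¹ i j + mulS (mulT (D B′)) i j ∎
  where
  open ≡-Reasoning
  open TopInsertion n
  Q : ℕ → ℕ → Bool
  Q x z = (x ≡ᵇ i) ∧ (z ≡ᵇ j)
  Aₑ Aₑ⁻¹ B′ : Poly
  Aₑ   = ascDesPoly (hasParity e) L
  Aₑ⁻¹ = ascDesPoly (hasParity (e ⁻¹)) L
  B′   = ascDesPoly (λ _ → true) L
  euler : ℕ
  euler = i * mulT B′ i j + j * mulS B′ i j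
  T₁ T₂ T₃ T₄ : List ℤ → ℕ
  T₁ σ = ascB σ * ⟦ Q (ascB σ) (suc (desB σ)) ⟧
  T₂ σ = desB σ * ⟦ Q (suc (ascB σ)) (desB σ) ⟧
  T₃ σ = ⟦ hasParity e σ ∧ Q (suc (ascB σ)) (desB σ) ⟧
  T₄ σ = ⟦ not (hasParity e σ) ∧ Q (ascB σ) (suc (desB σ)) ⟧

  weight : ∀ {σ} → IsSignedPerm n σ → countᵇ (selects e Q (+ 0)) (insertTop σ) ≡ T₁ σ + T₂ σ + T₃ σ + T₄ σ
  weight {σ} (_ , letters , ∣σ∣!) =
    countᵇ-insertTop e Q (+ 0) σ (z≤n ∷ All.map proj₂ letters) (Linked≢-0∷ letters ∣σ∣!)

  sum-T₃ : sum (map T₃ L) ≡ mulS Aₑ i j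
  sum-T₃ = trans (sum-map-Iverson _ L) (ascDesPoly-suc-asc (hasParity e) L i j)

  sum-T₄ : sum (map T₄ L) ≡ mulT Aₑ⁻¹ i j
  sum-T₄ = trans (sum-map-Iverson _ L)
    (trans (countᵇ-cong-local {xs = L} (All.tabulate λ {σ} _ →
              cong (_∧ Q (ascB σ) (suc (desB σ))) (not-≟ (parity (invB σ)) e)))
           (ascDesPoly-suc-des (hasParity (e ⁻¹)) L i j))

signedPerms-recurrence : ∀ n e →
  ascDesPoly (hasParity e) (signedPerms (suc n))
  ≈ₚ mulS (ascDesPoly (hasParity e) (signedPerms n)) ⊕ mulT (ascDesPoly (hasParity (e ⁻¹)) (signedPerms n))
     ⊕ mulS (mulT (D (B n)))
signedPerms-recurrence n e i j = trans
  (countᵇ-↭ _ (signedPerms-suc-↭ n))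
  (ascDesPoly-insertTop n e (signedPerms n) (All.tabulate (∈-signedPerms⁻ n)) i j)

B⁺≈ascDesPoly : ∀ n → B⁺ n ≈ₚ ascDesPoly (hasParity 0ℙ) (signedPerms n)
B⁺≈ascDesPoly n i j = countᵇ-cong-local {xs = signedPerms n} (All.tabulate λ {w} _ →
  cong (_∧ (ascB w ≡ᵇ i) ∧ (desB w ≡ᵇ j)) (isEven≡parity≟0ℙ (invB w)))

B⁻≈ascDesPoly : ∀ n → B⁻ n ≈ₚ ascDesPoly (hasParity 1ℙ) (signedPerms n)
B⁻≈ascDesPoly n i j = countᵇ-cong-local {xs = signedPerms n} (All.tabulate λ {w} _ →
  cong (_∧ (ascB w ≡ᵇ i) ∧ (desB w ≡ᵇ j))
       (trans (cong not (isEven≡parity≟0ℙ (invB w))) (not-≟ (parity (invB w)) 0ℙ)))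

theorem28 : (n : ℕ) → 2 ≤ n →
    (B⁺ n ≈ₚ mulS (B⁺ (n ∸ 1)) ⊕ mulT (B⁻ (n ∸ 1)) ⊕ mulS (mulT (D (B (n ∸ 1)))))
    × (B⁻ n ≈ₚ mulS (B⁻ (n ∸ 1)) ⊕ mulT (B⁺ (n ∸ 1)) ⊕ mulS (mulT (D (B (n ∸ 1)))))
-- The recurrence already holds for n = 1; the hypothesis only excludes n = 0.
theorem28 zero    ()
theorem28 (suc n) _ =
  transport 0ℙ (B⁺≈ascDesPoly (suc n)) (B⁺≈ascDesPoly n) (B⁻≈ascDesPoly n) ,
  transport 1ℙ (B⁻≈ascDesPoly (suc n)) (B⁻≈ascDesPoly n) (B⁺≈ascDesPoly n)
  where
  transport : ∀ e {P P′ P″} →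
    P ≈ₚ ascDesPoly (hasParity e) (signedPerms (suc n)) →
    P′ ≈ₚ ascDesPoly (hasParity e) (signedPerms n) → P″ ≈ₚ ascDesPoly (hasParity (e ⁻¹)) (signedPerms n) →
    P ≈ₚ mulS P′ ⊕ mulT P″ ⊕ mulS (mulT (D (B n)))
  transport e {P} {P′} {P″} P≈ P′≈ P″≈ i j = begin
    P i j
      ≡⟨ P≈ i j ⟩
    ascDesPoly (hasParity e) (signedPerms (suc n)) i j
      ≡⟨ signedPerms-recurrence n e i j ⟩
    mulS (ascDesPoly (hasParity e) (signedPerms n)) i j + mulT (ascDesPoly (hasParity (e ⁻¹)) (signedPerms n)) i j
      + mulS (mulT (D (B n))) i j
      ≡⟨ cong₂ (λ a b → a + b + mulS (mulT (D (B n))) i j) (mulS-cong P′≈ i j) (mulT-cong P″≈ i j) ⟨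
    mulS P′ i j + mulT P″ i j + mulS (mulT (D (B n))) i j ∎
    where open ≡-Reasoning
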